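{- For all integers $0\leq k\leq n$, \[ N_{n,k} = (-1)^{n-k} \sum_{j=0}^{n-k} (-1)^j \binom{n-1+j}{n-k+j} \binom{2n-k}{n-k-j} N_{n-k+j,j}. \]
   Context: The Narayana numbers are $N_{n,k}=\frac1n\binom{n}{k-1}\binom{n}{k}$ for $1\leq k\leq n$, with the conventions $N_{0,0}=1$ and $N_{n,0}=0$ for $n\geq1$. -}

module Defs where

open import Data.Nat using (ℕ; zero; suc; _+_; _*_; _∸_; _/_)
open import Data.Nat.Combinatorics using (_C_)
open import Data.Integer as ℤ using (ℤ; +_)

-- Narayana numbers N_{n,k} = (1/n) C(n,k-1) C(n,k) for 1 ≤ k ≤ n,
-- N_{0,0} = 1, N_{n,0} = 0 for n ≥ 1.  (For k > n the formula gives 0,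
-- since C(n,k) = 0; the division by n is exact.)
narayana : ℕ → ℕ → ℕ
narayana zero    zero    = 1
narayana (suc n) zero    = 0
narayana zero    (suc k) = 0
narayana (suc n) (suc k) = ((suc n C k) * (suc n C suc k)) / suc n

sgn : ℕ → ℤ
sgn zero    = + 1
sgn (suc m) = ℤ.- sgn m

sumTo : ℕ → (ℕ → ℤ) → ℤ
sumTo zero    f = f 0
sumTo (suc m) f = sumTo m f ℤ.+ f (suc m)

module Submission where

-- Put m = n − k and, for k ≥ 1, let F(m, k, j) be the j-th summand with C(2n−k, n−k−j) replaced by
-- its mirror image C(2n−k, n+j), so that F(m, k, j) = 0 for j > m, and S(m, k) = Σ_{j ≤ m} (−1)^j F(m, k, j).
-- With
--   A = m(m+1)(m+2)(m+1),  B = m(m+1)k(k+1),  D(j) = k(2m+1)(m+j)(m+k+j+1),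
--   G(0) = 0,  G(j+1) = (−1)^j D(j) F(m, k+1, j),
-- the summands form a WZ pair:  (−1)^j (A F(m+1, k, j) + B F(m, k+1, j)) = G(j+1) − G(j).
-- This is checked by writing F(m, k+1, j) and F(m, k+1, j−1) as rational multiples of F(m+1, k, j)
-- and clearing denominators.  Summing over j telescopes to
--   (m+2)(m+1) S(m+1, k) + k(k+1) S(m, k+1) = 0   for m ≥ 1,
-- the recurrence that (m+2)(m+1) N(n, k) = k(k+1) N(n, k+1), n = m + k + 1, gives along a row of
-- the Narayana triangle; induction on m from m = 0 and m = 1 yields N(m + k, k) = (−1)^m S(m, k).

open import Defs
open import Data.Integer as ℤ using (ℤ; +_)
import Data.Integer.Properties as ℤ
import Data.Integer.Tactic.RingSolver as ℤ-Solver
open import Data.List using (_∷_; [])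
open import Data.Nat using (ℕ; zero; suc; _+_; _*_; _∸_; _≤_; _<_; _≤?_; z≤n; s≤s; NonZero)
open import Data.Nat.Combinatorics
  using (_C_; nCk+nC[k+1]≡[n+1]C[k+1]; k>n⇒nCk≡0; nCn≡1; nC1≡n; nCk≡nC[n∸k])
open import Data.Nat.Divisibility using (_∣_; _∣0; ∣m+n∣m⇒∣n; m∣m*n)
open import Data.Nat.DivMod using (m*[n/m]≡n)
open import Data.Nat.Properties
open import Algebra.Properties.CommutativeSemigroup *-commutativeSemigroup using (interchange; x∙yz≈y∙xz)
open import Data.Nat.Tactic.RingSolver using (solve-∀; solve)
open import Data.Sum using (inj₁; inj₂)
open import Relation.Binary.PropositionalEquality
open import Relation.Nullary using (yes; no)
open ≡-Reasoning

m≡n+o⇒m∸n≡o : ∀ {m} n o → m ≡ n + o → m ∸ n ≡ o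
m≡n+o⇒m∸n≡o n o m≡n+o = trans (cong (_∸ n) m≡n+o) (m+n∸m≡n n o)

m+[1+n]∸n≡1+m : ∀ m n → m + suc n ∸ n ≡ suc m
m+[1+n]∸n≡1+m m n = trans (cong (_∸ n) (+-suc m n)) (m+n∸n≡m (suc m) n)

-- a * x ≡ b * y states the proportion x : y = b : a; proportions compose without cancellation.
proportion-trans : ∀ a b c d {x y z} → a * x ≡ b * y → c * y ≡ d * z → (c * a) * x ≡ (b * d) * z
proportion-trans a b c d {x} {y} {z} ax≡by cy≡dz = begin
  (c * a) * x  ≡⟨ *-assoc c a x ⟩
  c * (a * x)  ≡⟨ cong (c *_) ax≡by ⟩
  c * (b * y)  ≡⟨ x∙yz≈y∙xz c b y ⟩
  b * (c * y)  ≡⟨ cong (b *_) cy≡dz ⟩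
  b * (d * z)  ≡⟨ *-assoc b d z ⟨
  (b * d) * z  ∎

proportion-* : ∀ a b c d {x y u v} → a * x ≡ b * y → c * u ≡ d * v → (a * c) * (x * u) ≡ (b * d) * (y * v)
proportion-* a b c d {x} {y} {u} {v} ax≡by cu≡dv = begin
  (a * c) * (x * u)  ≡⟨ interchange a c x u ⟩
  (a * x) * (c * u)  ≡⟨ cong₂ _*_ ax≡by cu≡dv ⟩
  (b * y) * (d * v)  ≡⟨ interchange b y d v ⟩
  (b * d) * (y * v)  ∎

[1+k]*[1+n]C[1+k]≡[1+n]*nCk : ∀ n k → suc k * (suc n C suc k) ≡ suc n * (n C k)
[1+k]*[1+n]C[1+k]≡[1+n]*nCk n zero =
  trans (*-identityˡ (suc n C 1)) (trans (nC1≡n (suc n)) (sym (*-identityʳ (suc n))))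
[1+k]*[1+n]C[1+k]≡[1+n]*nCk zero (suc k) = begin
  suc (suc k) * (1 C suc (suc k))  ≡⟨ cong (suc (suc k) *_) (k>n⇒nCk≡0 {1} {suc (suc k)} (s≤s (s≤s z≤n))) ⟩
  suc (suc k) * 0                  ≡⟨ *-zeroʳ (suc (suc k)) ⟩
  0                                ≡⟨ cong (1 *_) (k>n⇒nCk≡0 {0} {suc k} (s≤s z≤n)) ⟨
  1 * (0 C suc k)                  ∎
[1+k]*[1+n]C[1+k]≡[1+n]*nCk (suc n) (suc k) = begin
  suc (suc k) * (suc (suc n) C suc (suc k))  ≡⟨ cong (suc (suc k) *_) (nCk+nC[k+1]≡[n+1]C[k+1] (suc n) (suc k)) ⟨
  suc (suc k) * (x + y)                      ≡⟨ split k x y ⟩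
  suc k * x + x + suc (suc k) * y            ≡⟨ cong₂ (λ p q → p + x + q) ([1+k]*[1+n]C[1+k]≡[1+n]*nCk n k)
                                                                         ([1+k]*[1+n]C[1+k]≡[1+n]*nCk n (suc k)) ⟩
  suc n * (n C k) + x + suc n * (n C suc k)  ≡⟨ collect n x (n C k) (n C suc k) ⟩
  suc n * (n C k + n C suc k) + x            ≡⟨ cong (λ p → suc n * p + x) (nCk+nC[k+1]≡[n+1]C[k+1] n k) ⟩
  suc n * x + x                              ≡⟨ +-comm (suc n * x) x ⟩
  suc (suc n) * x                            ∎
  where
  x = suc n C suc k
  y = suc n C suc (suc k)
  split : ∀ k x y → suc (suc k) * (x + y) ≡ suc k * x + x + suc (suc k) * y
  split = solve-∀
  collect : ∀ n x p q → suc n * p + x + suc n * q ≡ suc n * (p + q) + x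
  collect = solve-∀

[1+k]*nC[1+k]≡[n∸k]*nCk : ∀ n k → suc k * (n C suc k) ≡ (n ∸ k) * (n C k)
[1+k]*nC[1+k]≡[n∸k]*nCk n k with ≤-total k n
... | inj₁ k≤n = +-cancelʳ-≡ (suc k * (n C k)) _ _ (begin
  suc k * (n C suc k) + suc k * (n C k)  ≡⟨ *-distribˡ-+ (suc k) (n C suc k) (n C k) ⟨
  suc k * (n C suc k + n C k)            ≡⟨ cong (suc k *_) (+-comm (n C suc k) (n C k)) ⟩
  suc k * (n C k + n C suc k)            ≡⟨ cong (suc k *_) (nCk+nC[k+1]≡[n+1]C[k+1] n k) ⟩
  suc k * (suc n C suc k)                ≡⟨ [1+k]*[1+n]C[1+k]≡[1+n]*nCk n k ⟩
  suc n * (n C k)                        ≡⟨ cong (_* (n C k)) 1+n≡[n∸k]+[1+k] ⟩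
  ((n ∸ k) + suc k) * (n C k)            ≡⟨ *-distribʳ-+ (n C k) (n ∸ k) (suc k) ⟩
  (n ∸ k) * (n C k) + suc k * (n C k)    ∎)
  where
  1+n≡[n∸k]+[1+k] : suc n ≡ (n ∸ k) + suc k
  1+n≡[n∸k]+[1+k] = trans (cong suc (sym (m∸n+n≡m k≤n))) (sym (+-suc (n ∸ k) k))
... | inj₂ n≤k = begin
  suc k * (n C suc k)  ≡⟨ cong (suc k *_) (k>n⇒nCk≡0 (s≤s n≤k)) ⟩
  suc k * 0            ≡⟨ *-zeroʳ (suc k) ⟩
  0                    ≡⟨ cong (_* (n C k)) (m≤n⇒m∸n≡0 n≤k) ⟨
  (n ∸ k) * (n C k)    ∎

[1+n∸k]*[1+n]Ck≡[1+n]*nCk : ∀ n k → (suc n ∸ k) * (suc n C k) ≡ suc n * (n C k)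
[1+n∸k]*[1+n]Ck≡[1+n]*nCk n zero = refl
[1+n∸k]*[1+n]Ck≡[1+n]*nCk n (suc k) with ≤-total k n
... | inj₁ k≤n = begin
  (n ∸ k) * (suc n C suc k)                    ≡⟨ cong ((n ∸ k) *_) (nCk+nC[k+1]≡[n+1]C[k+1] n k) ⟨
  (n ∸ k) * (n C k + n C suc k)                ≡⟨ *-distribˡ-+ (n ∸ k) (n C k) (n C suc k) ⟩
  (n ∸ k) * (n C k) + (n ∸ k) * (n C suc k)    ≡⟨ cong (_+ (n ∸ k) * (n C suc k)) ([1+k]*nC[1+k]≡[n∸k]*nCk n k) ⟨
  suc k * (n C suc k) + (n ∸ k) * (n C suc k)  ≡⟨ *-distribʳ-+ (n C suc k) (suc k) (n ∸ k) ⟨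
  (suc k + (n ∸ k)) * (n C suc k)              ≡⟨ cong (λ c → suc c * (n C suc k)) (m+[n∸m]≡n k≤n) ⟩
  suc n * (n C suc k)                          ∎
... | inj₂ n≤k = begin
  (n ∸ k) * (suc n C suc k)  ≡⟨ cong (_* (suc n C suc k)) (m≤n⇒m∸n≡0 n≤k) ⟩
  0                          ≡⟨ *-zeroʳ (suc n) ⟨
  suc n * 0                  ≡⟨ cong (suc n *_) (k>n⇒nCk≡0 (s≤s n≤k)) ⟨
  suc n * (n C suc k)        ∎

-- (n+2)·P = (j+1)·P + (n+1−j)·P and both parts absorb a factor n+1 into one of the binomials,
-- so n+1 divides (n+2)·P − (n+1)·P = P.
narayana-divisible : ∀ n j → suc n ∣ (suc n C j) * (suc n C suc j)
narayana-divisible n j with ≤-total j (suc n)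
... | inj₂ 1+n≤j = subst (suc n ∣_) (sym (trans (cong (x *_) (k>n⇒nCk≡0 (s≤s 1+n≤j))) (*-zeroʳ x))) (suc n ∣0)
  where x = suc n C j
... | inj₁ j≤1+n = ∣m+n∣m⇒∣n (subst (suc n ∣_) (+-comm P (suc n * P)) divides-[2+n]*P) (m∣m*n P)
  where
  x = suc n C j
  y = suc n C suc j
  P = x * y
  split : ∀ a b x y → (a + suc b) * (x * y) ≡ suc a * y * x + b * x * y
  split = solve-∀
  collect : ∀ a c x y → a * c * x + a * c * y ≡ a * (c * (x + y))
  collect = solve-∀
  j+[1+[1+n∸j]]≡2+n : j + suc (suc n ∸ j) ≡ suc (suc n)
  j+[1+[1+n∸j]]≡2+n = trans (+-suc j (suc n ∸ j)) (cong suc (m+[n∸m]≡n j≤1+n))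
  divides-[2+n]*P : suc n ∣ suc (suc n) * P
  divides-[2+n]*P = subst (suc n ∣_) (sym (begin
    suc (suc n) * P                            ≡⟨ cong (_* P) (sym j+[1+[1+n∸j]]≡2+n) ⟩
    (j + suc (suc n ∸ j)) * P                  ≡⟨ split j (suc n ∸ j) x y ⟩
    suc j * y * x + (suc n ∸ j) * x * y        ≡⟨ cong₂ (λ p q → p * x + q * y) ([1+k]*[1+n]C[1+k]≡[1+n]*nCk n j)
                                                                                ([1+n∸k]*[1+n]Ck≡[1+n]*nCk n j) ⟩
    suc n * (n C j) * x + suc n * (n C j) * y  ≡⟨ collect (suc n) (n C j) x y ⟩
    suc n * ((n C j) * (x + y))                ∎)) (m∣m*n _)

narayana-formula : ∀ n j → n * narayana n (suc j) ≡ (n C j) * (n C suc j)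
narayana-formula zero    j = sym (trans (cong ((0 C j) *_) (k>n⇒nCk≡0 {0} {suc j} (s≤s z≤n))) (*-zeroʳ (0 C j)))
narayana-formula (suc n) j = m*[n/m]≡n (narayana-divisible n j)

narayana-diagonal : ∀ n → narayana (suc n) (suc n) ≡ 1
narayana-diagonal n = *-cancelˡ-≡ _ _ (suc n) (begin
  suc n * narayana (suc n) (suc n)  ≡⟨ narayana-formula (suc n) n ⟩
  (suc n C n) * (suc n C suc n)     ≡⟨ cong ((suc n C n) *_) (nCn≡1 (suc n)) ⟩
  (suc n C n) * 1                   ≡⟨ *-identityʳ (suc n C n) ⟩
  suc n C n                         ≡⟨ *-identityˡ (suc n C n) ⟨
  1 * (suc n C n)                   ≡⟨ cong (_* (suc n C n)) (m+n∸n≡m 1 n) ⟨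
  (suc n ∸ n) * (suc n C n)         ≡⟨ [1+n∸k]*[1+n]Ck≡[1+n]*nCk n n ⟩
  suc n * (n C n)                   ≡⟨ cong (suc n *_) (nCn≡1 n) ⟩
  suc n * 1                         ∎)

private
  rearrange : ∀ s n x → s * s * (n * x) ≡ s * (n * s * x)
  rearrange = solve-∀

narayana-row-ratio : ∀ n i → (suc n ∸ i) * (n ∸ i) * narayana (suc n) (suc i) ≡ n * suc n * narayana n (suc i)
narayana-row-ratio n i = *-cancelˡ-≡ _ _ (suc n) (begin
  suc n * (a * b * narayana (suc n) (suc i))  ≡⟨ x∙yz≈y∙xz (suc n) (a * b) (narayana (suc n) (suc i)) ⟩
  a * b * (suc n * narayana (suc n) (suc i))  ≡⟨ cong (a * b *_) (narayana-formula (suc n) i) ⟩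
  a * b * ((suc n C i) * (suc n C suc i))     ≡⟨ proportion-* a (suc n) b (suc n) ([1+n∸k]*[1+n]Ck≡[1+n]*nCk n i)
                                                                                   ([1+n∸k]*[1+n]Ck≡[1+n]*nCk n (suc i)) ⟩
  suc n * suc n * ((n C i) * (n C suc i))     ≡⟨ cong (suc n * suc n *_) (narayana-formula n i) ⟨
  suc n * suc n * (n * narayana n (suc i))    ≡⟨ rearrange (suc n) n (narayana n (suc i)) ⟩
  suc n * (n * suc n * narayana n (suc i))    ∎)
  where
  a = suc n ∸ i
  b = n ∸ i

narayana-diagonal-ratio : ∀ n j → j * suc j * narayana (suc n) (suc j) ≡ n * suc n * narayana n j
narayana-diagonal-ratio zero    zero    = refl
narayana-diagonal-ratio (suc n) zero    = sym (*-zeroʳ (suc n * suc (suc n)))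
narayana-diagonal-ratio n       (suc i) = *-cancelˡ-≡ _ _ (suc n) (begin
  suc n * (a * b * narayana (suc n) (suc a))  ≡⟨ x∙yz≈y∙xz (suc n) (a * b) (narayana (suc n) (suc a)) ⟩
  a * b * (suc n * narayana (suc n) (suc a))  ≡⟨ cong (a * b *_) (narayana-formula (suc n) a) ⟩
  a * b * ((suc n C a) * (suc n C b))         ≡⟨ proportion-* a (suc n) b (suc n) ([1+k]*[1+n]C[1+k]≡[1+n]*nCk n i)
                                                                                   ([1+k]*[1+n]C[1+k]≡[1+n]*nCk n a) ⟩
  suc n * suc n * ((n C i) * (n C a))         ≡⟨ cong (suc n * suc n *_) (narayana-formula n i) ⟨
  suc n * suc n * (n * narayana n a)          ≡⟨ rearrange (suc n) n (narayana n a) ⟩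
  suc n * (n * suc n * narayana n a)          ∎)
  where
  a = suc i
  b = suc a

narayana-column-ratio : ∀ n k →
  (n ∸ k) * (n ∸ suc k) * narayana n (suc k) ≡ suc k * suc (suc k) * narayana n (suc (suc k))
narayana-column-ratio zero    k = trans (*-zeroʳ ((0 ∸ k) * (0 ∸ suc k))) (sym (*-zeroʳ (suc k * suc (suc k))))
narayana-column-ratio (suc n) k = *-cancelˡ-≡ _ _ (suc n) (begin
  suc n * (a * b * N₁)                                     ≡⟨ x∙yz≈y∙xz (suc n) (a * b) N₁ ⟩
  a * b * (suc n * N₁)                                     ≡⟨ cong (a * b *_) (narayana-formula (suc n) k) ⟩
  a * b * ((suc n C k) * (suc n C suc k))                  ≡⟨ proportion-* a (suc k) b (suc (suc k))
                                                                (sym ([1+k]*nC[1+k]≡[n∸k]*nCk (suc n) k))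
                                                                (sym ([1+k]*nC[1+k]≡[n∸k]*nCk (suc n) (suc k))) ⟩
  c * ((suc n C suc k) * (suc n C suc (suc k)))            ≡⟨ cong (c *_) (narayana-formula (suc n) (suc k)) ⟨
  c * (suc n * N₂)                                         ≡⟨ x∙yz≈y∙xz c (suc n) N₂ ⟩
  suc n * (c * N₂)                                         ∎)
  where
  a = suc n ∸ k
  b = suc n ∸ suc k
  c = suc k * suc (suc k)
  N₁ = narayana (suc n) (suc k)
  N₂ = narayana (suc n) (suc (suc k))

-- summand m k j is the j-th summand for n = m + suc k and the theorem's k equal to suc k, with
-- C(2n−k, n−k−j) replaced by the mirror image C(2n−k, n+j), which also vanishes for j > m.
summand : ℕ → ℕ → ℕ → ℕ
summand m k j = ((m + k + j) C (m + j)) * ((m + m + suc k) C (m + suc k + j)) * narayana (m + j) j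

summand-vanishes : ∀ m k j → m < j → summand m k j ≡ 0
summand-vanishes m k j m<j = begin
  x * ((m + m + suc k) C (m + suc k + j)) * y  ≡⟨ cong (λ t → x * t * y) (k>n⇒nCk≡0 upper<lower) ⟩
  x * 0 * y                                    ≡⟨ cong (_* y) (*-zeroʳ x) ⟩
  0                                            ∎
  where
  x = (m + k + j) C (m + j)
  y = narayana (m + j) j
  reorder : m + suc k + m ≡ m + m + suc k
  reorder = solve (m ∷ k ∷ [])
  upper<lower : m + m + suc k < m + suc k + j
  upper<lower = subst (_< m + suc k + j) reorder (+-monoʳ-< (m + suc k) m<j)

summand-at-zero : ∀ m k → summand (suc m) k 0 ≡ 0
summand-at-zero m k = *-zeroʳ (((suc m + k + 0) C (suc m + 0)) * ((suc m + suc m + suc k) C (suc m + suc k + 0)))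

narayana-row-ratio′ : ∀ m i →
  suc (suc m) * suc m * narayana (suc (m + suc i)) (suc i) ≡ (m + suc i) * suc (m + suc i) * narayana (m + suc i) (suc i)
narayana-row-ratio′ m i =
  trans (cong (_* narayana (suc (m + suc i)) (suc i)) (sym (cong₂ _*_ (m+[1+n]∸n≡1+m (suc m) i) (m+[1+n]∸n≡1+m m i))))
        (narayana-row-ratio (m + suc i) i)

-- In the WZ step, X = summand (suc m) k (suc i), Y = summand m (suc k) (suc i) and
-- Z = summand m (suc k) i; these are the coefficients of the proportions X : Y and X : Z.
ratio-XY-X : ℕ → ℕ → ℕ
ratio-XY-X m i = suc (m + suc i) * (m ∸ i) * (suc (suc m) * suc m)

ratio-XY-Y : ℕ → ℕ → ℕ → ℕ
ratio-XY-Y m k i = suc k * (suc m + suc m + suc k) * ((m + suc i) * suc (m + suc i))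

ratio-XZ-X : ℕ → ℕ → ℕ → ℕ
ratio-XZ-X m k i = (m + suc i) * suc (m + suc i) * (suc m + suc k + suc i) * (i * suc i * (suc (suc m) * suc m))

ratio-XZ-Z : ℕ → ℕ → ℕ → ℕ
ratio-XZ-Z m k i =
  suc k * suc (m + k + suc i) * (suc m + suc m + suc k) * ((m + suc i) * suc (m + suc i) * ((m + i) * suc (m + i)))

summand-ratio-XY : ∀ m k i →
  ratio-XY-X m i * summand (suc m) k (suc i) ≡ ratio-XY-Y m k i * summand m (suc k) (suc i)
summand-ratio-XY m k i =
  proportion-* (suc a * (m ∸ i)) (suc k * suc p) (suc (suc m) * suc m) (a * suc a)
    (proportion-* (suc a) (suc k) (m ∸ i) (suc p) first second) (narayana-row-ratio′ m i)
  where
  a = m + suc i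
  N = m + k + suc i
  p = m + suc m + suc k
  q = suc m + suc k + suc i
  1+N≡a+[1+k] : suc (m + k + suc i) ≡ m + suc i + suc k
  1+N≡a+[1+k] = solve (m ∷ k ∷ i ∷ [])
  1+N≡ : suc (m + k + suc i) ≡ m + suc k + suc i
  1+N≡ = solve (m ∷ k ∷ i ∷ [])
  1+N∸a≡1+k : suc N ∸ a ≡ suc k
  1+N∸a≡1+k = m≡n+o⇒m∸n≡o a (suc k) 1+N≡a+[1+k]
  p≡ : m + suc m + suc k ≡ m + m + suc (suc k)
  p≡ = solve (m ∷ k ∷ [])
  q≡ : suc m + suc k + suc i ≡ m + suc (suc k) + suc i
  q≡ = solve (m ∷ k ∷ i ∷ [])
  1+p≡ : suc (m + suc m + suc k) ≡ m + suc (suc (suc k)) + m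
  1+p≡ = solve (m ∷ k ∷ [])
  q≡′ : suc m + suc k + suc i ≡ m + suc (suc (suc k)) + i
  q≡′ = solve (m ∷ k ∷ i ∷ [])
  m∸i≡1+p∸q : m ∸ i ≡ suc p ∸ q
  m∸i≡1+p∸q = trans (sym ([m+n]∸[m+o]≡n∸o (m + suc (suc (suc k))) m i)) (sym (cong₂ _∸_ 1+p≡ q≡′))
  first : suc a * (suc N C suc a) ≡ suc k * ((m + suc k + suc i) C a)
  first = begin
    suc a * (suc N C suc a)            ≡⟨ [1+k]*nC[1+k]≡[n∸k]*nCk (suc N) a ⟩
    (suc N ∸ a) * (suc N C a)          ≡⟨ cong₂ (λ c t → c * (t C a)) 1+N∸a≡1+k 1+N≡ ⟩
    suc k * ((m + suc k + suc i) C a)  ∎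
  second : (m ∸ i) * (suc p C q) ≡ suc p * ((m + m + suc (suc k)) C (m + suc (suc k) + suc i))
  second = begin
    (m ∸ i) * (suc p C q)      ≡⟨ cong (_* (suc p C q)) m∸i≡1+p∸q ⟩
    (suc p ∸ q) * (suc p C q)  ≡⟨ [1+n∸k]*[1+n]Ck≡[1+n]*nCk p q ⟩
    suc p * (p C q)            ≡⟨ cong (suc p *_) (cong₂ _C_ p≡ q≡) ⟩
    suc p * ((m + m + suc (suc k)) C (m + suc (suc k) + suc i)) ∎

summand-ratio-XZ : ∀ m k i →
  ratio-XZ-X m k i * summand (suc m) k (suc i) ≡ ratio-XZ-Z m k i * summand m (suc k) i
summand-ratio-XZ m k i =
  proportion-* (a * suc a * suc q) (suc k * suc N * suc p)
               (i * suc i * (suc (suc m) * suc m)) (a * suc a * ((m + i) * suc (m + i)))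
    (proportion-* (a * suc a) (suc k * suc N) (suc q) (suc p)
      (proportion-trans (suc a) (suc k) a (suc N) first-ratio first-absorb) second)
    (proportion-trans (suc (suc m) * suc m) (a * suc a) (i * suc i) ((m + i) * suc (m + i)) (narayana-row-ratio′ m i) third)
  where
  a = m + suc i
  N = m + k + suc i
  p = m + suc m + suc k
  q = m + suc k + suc i
  1+N≡a+[1+k] : suc (m + k + suc i) ≡ m + suc i + suc k
  1+N≡a+[1+k] = solve (m ∷ k ∷ i ∷ [])
  1+N≡ : suc (m + suc k + i) ≡ suc (m + k + suc i)
  1+N≡ = solve (m ∷ k ∷ i ∷ [])
  p≡ : m + suc m + suc k ≡ m + m + suc (suc k)
  p≡ = solve (m ∷ k ∷ [])
  q≡ : m + suc k + suc i ≡ m + suc (suc k) + i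
  q≡ = solve (m ∷ k ∷ i ∷ [])
  first-ratio : suc a * (suc N C suc a) ≡ suc k * (suc N C a)
  first-ratio = trans ([1+k]*nC[1+k]≡[n∸k]*nCk (suc N) a)
                      (cong (_* (suc N C a)) (m≡n+o⇒m∸n≡o a (suc k) 1+N≡a+[1+k]))
  first-absorb : a * (suc N C a) ≡ suc N * ((m + suc k + i) C (m + i))
  first-absorb = begin
    a * (suc N C a)                                    ≡⟨ cong₂ (λ c t → c * (t C c)) (+-suc m i) (sym 1+N≡) ⟩
    suc (m + i) * (suc (m + suc k + i) C suc (m + i))  ≡⟨ [1+k]*[1+n]C[1+k]≡[1+n]*nCk (m + suc k + i) (m + i) ⟩
    suc (m + suc k + i) * ((m + suc k + i) C (m + i))  ≡⟨ cong (_* ((m + suc k + i) C (m + i))) 1+N≡ ⟩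
    suc N * ((m + suc k + i) C (m + i))                ∎
  second : suc q * (suc p C suc q) ≡ suc p * ((m + m + suc (suc k)) C (m + suc (suc k) + i))
  second = trans ([1+k]*[1+n]C[1+k]≡[1+n]*nCk p q) (cong (suc p *_) (cong₂ _C_ p≡ q≡))
  third : i * suc i * narayana a (suc i) ≡ (m + i) * suc (m + i) * narayana (m + i) i
  third = begin
    i * suc i * narayana a (suc i)              ≡⟨ cong (λ n → i * suc i * narayana n (suc i)) (+-suc m i) ⟩
    i * suc i * narayana (suc (m + i)) (suc i)  ≡⟨ narayana-diagonal-ratio (m + i) i ⟩
    (m + i) * suc (m + i) * narayana (m + i) i  ∎

wz-A : ℕ → ℕ
wz-A m = m * suc m * (suc (suc m) * suc m)

wz-B : ℕ → ℕ → ℕ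
wz-B m k = m * suc m * (suc k * suc (suc k))

wz-D : ℕ → ℕ → ℕ → ℕ
wz-D m k j = suc k * suc (m + m) * (m + j) * suc (m + suc k + j)

combine-proportions : ∀ {A B D D′ X Y Z} cY eY cZ eZ .{{_ : NonZero eY}} .{{_ : NonZero eZ}} →
  cY * X ≡ eY * Y → cZ * X ≡ eZ * Z →
  eY * eZ * A + eZ * B * cY ≡ eZ * D * cY + eY * D′ * cZ →
  A * X + B * Y ≡ D * Y + D′ * Z
combine-proportions {A} {B} {D} {D′} {X} {Y} {Z} cY eY cZ eZ X∶Y X∶Z coefficients =
  *-cancelˡ-≡ _ _ (eY * eZ) {{m*n≢0 eY eZ}} (begin
    eY * eZ * (A * X + B * Y)               ≡⟨ solve (eY ∷ eZ ∷ A ∷ X ∷ B ∷ Y ∷ []) ⟩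
    eY * eZ * A * X + eZ * B * (eY * Y)     ≡⟨ cong (λ t → eY * eZ * A * X + eZ * B * t) X∶Y ⟨
    eY * eZ * A * X + eZ * B * (cY * X)     ≡⟨ solve (eY ∷ eZ ∷ A ∷ X ∷ B ∷ cY ∷ []) ⟩
    (eY * eZ * A + eZ * B * cY) * X         ≡⟨ cong (_* X) coefficients ⟩
    (eZ * D * cY + eY * D′ * cZ) * X        ≡⟨ solve (eZ ∷ D ∷ cY ∷ eY ∷ D′ ∷ cZ ∷ X ∷ []) ⟩
    eZ * D * (cY * X) + eY * D′ * (cZ * X)  ≡⟨ cong₂ (λ s t → eZ * D * s + eY * D′ * t) X∶Y X∶Z ⟩
    eZ * D * (eY * Y) + eY * D′ * (eZ * Z)  ≡⟨ solve (eZ ∷ D ∷ eY ∷ Y ∷ D′ ∷ Z ∷ []) ⟩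
    eY * eZ * (D * Y + D′ * Z)              ∎)

-- The termwise identity multiplied by eY·eZ, where cY, eY, cZ, eZ are ratio-XY-X, ratio-XY-Y,
-- ratio-XZ-X, ratio-XZ-Z with m ∸ i written as r.
wz-certificate-identity : ∀ m k i r → m ≡ i + r →
  let a  = m + suc i
      cY = suc (m + suc i) * r * (suc (suc m) * suc m)
      eY = suc k * (suc m + suc m + suc k) * ((m + suc i) * suc (m + suc i))
      cZ = a * suc a * (suc m + suc k + suc i) * (i * suc i * (suc (suc m) * suc m))
      eZ = suc k * suc (m + k + suc i) * (suc m + suc m + suc k) * (a * suc a * ((m + i) * suc (m + i)))
  in eY * eZ * (m * suc m * (suc (suc m) * suc m)) + eZ * (m * suc m * (suc k * suc (suc k))) * cY
     ≡ eZ * (suc k * suc (m + m) * (m + suc i) * suc (m + suc k + suc i)) * cY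
       + eY * (suc k * suc (m + m) * (m + i) * suc (m + suc k + i)) * cZ
wz-certificate-identity .(i + r) k i r refl = solve (i ∷ r ∷ k ∷ [])

-- X is the reference term of the proportions: Y vanishes for i = m while X and Z do not.
wz-termwise : ∀ m k i → .{{NonZero m}} →
  wz-A m * summand (suc m) k (suc i) + wz-B m k * summand m (suc k) (suc i)
  ≡ wz-D m k (suc i) * summand m (suc k) (suc i) + wz-D m k i * summand m (suc k) i
wz-termwise m@(suc _) k i with i ≤? m
... | yes i≤m =
  combine-proportions {wz-A m} {wz-B m k} {wz-D m k (suc i)} {wz-D m k i}
    {summand (suc m) k (suc i)} {summand m (suc k) (suc i)} {summand m (suc k) i}
    (ratio-XY-X m i) (ratio-XY-Y m k i) (ratio-XZ-X m k i) (ratio-XZ-Z m k i)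
    (summand-ratio-XY m k i) (summand-ratio-XZ m k i)
    (wz-certificate-identity m k i (m ∸ i) (sym (m+[n∸m]≡n i≤m)))
... | no i≰m
  rewrite summand-vanishes (suc m) k (suc i) (s≤s (≰⇒> i≰m))
        | summand-vanishes m (suc k) (suc i) (m<n⇒m<1+n (≰⇒> i≰m))
        | summand-vanishes m (suc k) i (≰⇒> i≰m)
  = trans (cong₂ _+_ (*-zeroʳ (wz-A m)) (*-zeroʳ (wz-B m k)))
          (sym (cong₂ _+_ (*-zeroʳ (wz-D m k (suc i))) (*-zeroʳ (wz-D m k i))))

sumTo-cong : ∀ M {f g : ℕ → ℤ} → (∀ j → j ≤ M → f j ≡ g j) → sumTo M f ≡ sumTo M g
sumTo-cong zero    f≗g = f≗g 0 z≤n
sumTo-cong (suc M) f≗g =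
  cong₂ ℤ._+_ (sumTo-cong M (λ j j≤M → f≗g j (m≤n⇒m≤1+n j≤M))) (f≗g (suc M) ≤-refl)

sumTo-vanishing : ∀ M {f : ℕ → ℤ} → (∀ j → f j ≡ + 0) → sumTo M f ≡ + 0
sumTo-vanishing zero    f≗0 = f≗0 0
sumTo-vanishing (suc M) f≗0 = cong₂ ℤ._+_ (sumTo-vanishing M f≗0) (f≗0 (suc M))

sumTo-linear : ∀ M (a b : ℤ) (f g : ℕ → ℤ) →
  sumTo M (λ j → a ℤ.* f j ℤ.+ b ℤ.* g j) ≡ a ℤ.* sumTo M f ℤ.+ b ℤ.* sumTo M g
sumTo-linear zero    a b f g = refl
sumTo-linear (suc M) a b f g =
  trans (cong (ℤ._+ (a ℤ.* f (suc M) ℤ.+ b ℤ.* g (suc M))) (sumTo-linear M a b f g))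
        (regroup a b (sumTo M f) (sumTo M g) (f (suc M)) (g (suc M)))
  where
  regroup : ∀ a b x y u v → a ℤ.* x ℤ.+ b ℤ.* y ℤ.+ (a ℤ.* u ℤ.+ b ℤ.* v) ≡ a ℤ.* (x ℤ.+ u) ℤ.+ b ℤ.* (y ℤ.+ v)
  regroup = ℤ-Solver.solve-∀

sumTo-telescope : ∀ M (h : ℕ → ℤ) → sumTo M (λ j → h (suc j) ℤ.- h j) ≡ h (suc M) ℤ.- h 0
sumTo-telescope zero    h = refl
sumTo-telescope (suc M) h =
  trans (cong (ℤ._+ (h (suc (suc M)) ℤ.- h (suc M))) (sumTo-telescope M h))
        (cancel (h (suc M)) (h 0) (h (suc (suc M))))
  where
  cancel : ∀ x y z → x ℤ.- y ℤ.+ (z ℤ.- x) ≡ z ℤ.- y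
  cancel = ℤ-Solver.solve-∀

signed-summand : ℕ → ℕ → ℕ → ℤ
signed-summand m k j = sgn j ℤ.* + summand m k j

signed-summand-vanishes : ∀ m k j → m < j → signed-summand m k j ≡ + 0
signed-summand-vanishes m k j m<j =
  trans (cong (λ t → sgn j ℤ.* + t) (summand-vanishes m k j m<j)) (ℤ.*-zeroʳ (sgn j))

wz-G : ℕ → ℕ → ℕ → ℤ
wz-G m k zero    = + 0
wz-G m k (suc j) = + wz-D m k j ℤ.* signed-summand m (suc k) j

signed-combination : ∀ {A B D D′ X Y Z} (s : ℤ) → A * X + B * Y ≡ D * Y + D′ * Z →
  + A ℤ.* (ℤ.- s ℤ.* + X) ℤ.+ + B ℤ.* (ℤ.- s ℤ.* + Y) ≡ + D ℤ.* (ℤ.- s ℤ.* + Y) ℤ.- + D′ ℤ.* (s ℤ.* + Z)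
signed-combination {A} {B} {D} {D′} {X} {Y} {Z} s eq = begin
  + A ℤ.* (ℤ.- s ℤ.* + X) ℤ.+ + B ℤ.* (ℤ.- s ℤ.* + Y)  ≡⟨ factor-out s (+ A) (+ X) (+ B) (+ Y) ⟩
  ℤ.- s ℤ.* (+ A ℤ.* + X ℤ.+ + B ℤ.* + Y)               ≡⟨ cong (ℤ.- s ℤ.*_) (trans (sym (pos-linear A X B Y))
                                                                          (trans (cong +_ eq) (pos-linear D Y D′ Z))) ⟩
  ℤ.- s ℤ.* (+ D ℤ.* + Y ℤ.+ + D′ ℤ.* + Z)              ≡⟨ distribute s (+ D) (+ Y) (+ D′) (+ Z) ⟩
  + D ℤ.* (ℤ.- s ℤ.* + Y) ℤ.- + D′ ℤ.* (s ℤ.* + Z)      ∎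
  where
  factor-out : ∀ s a x b y → a ℤ.* (ℤ.- s ℤ.* x) ℤ.+ b ℤ.* (ℤ.- s ℤ.* y) ≡ ℤ.- s ℤ.* (a ℤ.* x ℤ.+ b ℤ.* y)
  factor-out = ℤ-Solver.solve-∀
  distribute : ∀ s d y d′ z → ℤ.- s ℤ.* (d ℤ.* y ℤ.+ d′ ℤ.* z) ≡ d ℤ.* (ℤ.- s ℤ.* y) ℤ.- d′ ℤ.* (s ℤ.* z)
  distribute = ℤ-Solver.solve-∀
  pos-linear : ∀ a x b y → + (a * x + b * y) ≡ + a ℤ.* + x ℤ.+ + b ℤ.* + y
  pos-linear a x b y = trans (ℤ.pos-+ (a * x) (b * y)) (cong₂ ℤ._+_ (ℤ.pos-* a x) (ℤ.pos-* b y))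

wz-telescoping : ∀ m k j → .{{NonZero m}} →
  + wz-A m ℤ.* signed-summand (suc m) k j ℤ.+ + wz-B m k ℤ.* signed-summand m (suc k) j
  ≡ wz-G m k (suc j) ℤ.- wz-G m k j
wz-telescoping m@(suc m′) k zero rewrite summand-at-zero m k | summand-at-zero m′ (suc k) =
  zeros (+ wz-A m) (+ wz-B m k) (+ wz-D m k 0)
  where
  zeros : ∀ a b d → a ℤ.* (+ 1 ℤ.* + 0) ℤ.+ b ℤ.* (+ 1 ℤ.* + 0) ≡ d ℤ.* (+ 1 ℤ.* + 0) ℤ.- + 0
  zeros = ℤ-Solver.solve-∀
wz-telescoping m@(suc _) k (suc i) =
  signed-combination {wz-A m} {wz-B m k} {wz-D m k (suc i)} {wz-D m k i}
    {summand (suc m) k (suc i)} {summand m (suc k) (suc i)} {summand m (suc k) i} (sgn i) (wz-termwise m k i)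

wz-sum : ∀ m k → .{{NonZero m}} →
  + wz-A m ℤ.* sumTo (suc m) (signed-summand (suc m) k) ℤ.+ + wz-B m k ℤ.* sumTo m (signed-summand m (suc k)) ≡ + 0
wz-sum m@(suc _) k = begin
  + A ℤ.* sumTo (suc m) X ℤ.+ + B ℤ.* sumTo m Y          ≡⟨ cong (λ t → + A ℤ.* sumTo (suc m) X ℤ.+ + B ℤ.* t) Y-extends ⟩
  + A ℤ.* sumTo (suc m) X ℤ.+ + B ℤ.* sumTo (suc m) Y    ≡⟨ sumTo-linear (suc m) (+ A) (+ B) X Y ⟨
  sumTo (suc m) (λ j → + A ℤ.* X j ℤ.+ + B ℤ.* Y j)      ≡⟨ sumTo-cong (suc m) (λ j _ → wz-telescoping m k j) ⟩
  sumTo (suc m) (λ j → wz-G m k (suc j) ℤ.- wz-G m k j)  ≡⟨ sumTo-telescope (suc m) (wz-G m k) ⟩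
  + D ℤ.* Y (suc m) ℤ.- + 0                              ≡⟨ cong (λ t → + D ℤ.* t ℤ.- + 0) Y-beyond ⟩
  + D ℤ.* + 0 ℤ.- + 0                                    ≡⟨ trans (ℤ.+-identityʳ (+ D ℤ.* + 0)) (ℤ.*-zeroʳ (+ D)) ⟩
  + 0                                                    ∎
  where
  A = wz-A m
  B = wz-B m k
  D = wz-D m k (suc m)
  X = signed-summand (suc m) k
  Y = signed-summand m (suc k)
  Y-beyond : Y (suc m) ≡ + 0
  Y-beyond = signed-summand-vanishes m (suc k) (suc m) ≤-refl
  Y-extends : sumTo m Y ≡ sumTo (suc m) Y
  Y-extends = sym (trans (cong (λ t → sumTo m Y ℤ.+ t) Y-beyond) (ℤ.+-identityʳ (sumTo m Y)))

transfer-expansion : ∀ {c a b N₁ N₂ : ℕ} {s S₁ S₂ : ℤ} .{{_ : NonZero (c * a)}} →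
  a * N₁ ≡ b * N₂ → + N₂ ≡ s ℤ.* S₂ → + (c * a) ℤ.* S₁ ℤ.+ + (c * b) ℤ.* S₂ ≡ + 0 →
  + N₁ ≡ ℤ.- s ℤ.* S₁
transfer-expansion {c} {a} {b} {N₁} {N₂} {s} {S₁} {S₂} ratio expansion₂ relation =
  ℤ.*-cancelˡ-≡ (+ (c * a)) (+ N₁) (ℤ.- s ℤ.* S₁) (begin
    + (c * a) ℤ.* + N₁                        ≡⟨ ℤ.pos-* (c * a) N₁ ⟨
    + (c * a * N₁)                            ≡⟨ cong +_ (trans (*-assoc c a N₁) (cong (c *_) ratio)) ⟩
    + (c * (b * N₂))                          ≡⟨ trans (ℤ.pos-* c (b * N₂)) (cong (+ c ℤ.*_) (ℤ.pos-* b N₂)) ⟩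
    + c ℤ.* (+ b ℤ.* + N₂)                    ≡⟨ cong (λ t → + c ℤ.* (+ b ℤ.* t)) expansion₂ ⟩
    + c ℤ.* (+ b ℤ.* (s ℤ.* S₂))              ≡⟨ regroup (+ c) (+ a) (+ b) s S₁ S₂ ⟩
    s ℤ.* (ca ℤ.* S₁ ℤ.+ cb ℤ.* S₂) ℤ.- s ℤ.* (ca ℤ.* S₁)
                                              ≡⟨ cong (λ t → s ℤ.* t ℤ.- s ℤ.* (ca ℤ.* S₁)) relation′ ⟩
    s ℤ.* + 0 ℤ.- s ℤ.* (ca ℤ.* S₁)           ≡⟨ conclude (+ c) (+ a) s S₁ ⟩
    ca ℤ.* (ℤ.- s ℤ.* S₁)                     ≡⟨ cong (ℤ._* (ℤ.- s ℤ.* S₁)) (ℤ.pos-* c a) ⟨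
    + (c * a) ℤ.* (ℤ.- s ℤ.* S₁)              ∎)
  where
  ca = + c ℤ.* + a
  cb = + c ℤ.* + b
  relation′ : ca ℤ.* S₁ ℤ.+ cb ℤ.* S₂ ≡ + 0
  relation′ = trans (cong₂ (λ x y → x ℤ.* S₁ ℤ.+ y ℤ.* S₂) (sym (ℤ.pos-* c a)) (sym (ℤ.pos-* c b))) relation
  regroup : ∀ c a b s S₁ S₂ →
    c ℤ.* (b ℤ.* (s ℤ.* S₂)) ≡ s ℤ.* (c ℤ.* a ℤ.* S₁ ℤ.+ c ℤ.* b ℤ.* S₂) ℤ.- s ℤ.* (c ℤ.* a ℤ.* S₁)
  regroup = ℤ-Solver.solve-∀
  conclude : ∀ c a s S₁ → s ℤ.* + 0 ℤ.- s ℤ.* (c ℤ.* a ℤ.* S₁) ≡ c ℤ.* a ℤ.* (ℤ.- s ℤ.* S₁)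
  conclude = ℤ-Solver.solve-∀

narayana-expansion-0 : ∀ k → + narayana (0 + suc k) (suc k) ≡ sgn 0 ℤ.* sumTo 0 (signed-summand 0 k)
narayana-expansion-0 k = begin
  + narayana (suc k) (suc k)             ≡⟨ cong +_ (trans (narayana-diagonal k) (sym only-term)) ⟩
  + summand 0 k 0                        ≡⟨ ℤ.*-identityˡ (+ summand 0 k 0) ⟨
  sgn 0 ℤ.* + summand 0 k 0              ≡⟨ ℤ.*-identityˡ (sgn 0 ℤ.* + summand 0 k 0) ⟨
  sgn 0 ℤ.* (sgn 0 ℤ.* + summand 0 k 0)  ∎
  where
  only-term : summand 0 k 0 ≡ 1
  only-term = trans (cong (λ t → 1 * (suc k C t) * 1) (+-identityʳ (suc k))) (cong (λ t → 1 * t * 1) (nCn≡1 (suc k)))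

narayana-expansion-1 : ∀ k → + narayana (1 + suc k) (suc k) ≡ sgn 1 ℤ.* sumTo 1 (signed-summand 1 k)
narayana-expansion-1 k = begin
  + narayana n (suc k)                                      ≡⟨ cong +_ (trans narayana≡nC2 (sym second-term)) ⟩
  + summand 1 k 1                                           ≡⟨ only-second (+ summand 1 k 1) ⟩
  ℤ.- + 1 ℤ.* (+ 1 ℤ.* + 0 ℤ.+ ℤ.- + 1 ℤ.* + summand 1 k 1)
    ≡⟨ cong (λ t → ℤ.- + 1 ℤ.* (+ 1 ℤ.* + t ℤ.+ ℤ.- + 1 ℤ.* + summand 1 k 1)) (summand-at-zero 0 k) ⟨
  sgn 1 ℤ.* sumTo 1 (signed-summand 1 k)                    ∎
  where
  n = suc (suc k)
  only-second : ∀ x → x ≡ ℤ.- + 1 ℤ.* (+ 1 ℤ.* + 0 ℤ.+ ℤ.- + 1 ℤ.* x)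
  only-second = ℤ-Solver.solve-∀
  second-term : summand 1 k 1 ≡ n C 2
  second-term = begin
    (suc (k + 1) C 2) * (suc (suc (suc k)) C suc (suc (k + 1))) * 1
                                   ≡⟨ cong (λ t → (suc t C 2) * (suc (suc (suc k)) C suc (suc t)) * 1) (+-comm k 1) ⟩
    (n C 2) * (suc n C suc n) * 1  ≡⟨ cong (λ t → (n C 2) * t * 1) (nCn≡1 (suc n)) ⟩
    (n C 2) * 1 * 1                ≡⟨ trans (*-identityʳ ((n C 2) * 1)) (*-identityʳ (n C 2)) ⟩
    n C 2                          ∎
  narayana≡nC2 : narayana n (suc k) ≡ n C 2
  narayana≡nC2 = *-cancelˡ-≡ _ _ 2 (begin
    2 * narayana n (suc k)                      ≡⟨ cong (_* narayana n (suc k)) (cong₂ _*_ (m+n∸n≡m 2 k) (m+n∸n≡m 1 k)) ⟨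
    (n ∸ k) * (n ∸ suc k) * narayana n (suc k)  ≡⟨ narayana-column-ratio n k ⟩
    suc k * n * narayana n n                    ≡⟨ cong (suc k * n *_) (narayana-diagonal (suc k)) ⟩
    suc k * n * 1                               ≡⟨ trans (*-identityʳ (suc k * n)) (*-comm (suc k) n) ⟩
    n * suc k                                   ≡⟨ cong (n *_) (nC1≡n (suc k)) ⟨
    n * (suc k C 1)                             ≡⟨ [1+k]*[1+n]C[1+k]≡[1+n]*nCk (suc k) 1 ⟨
    2 * (n C 2)                                 ∎)

narayana-expansion : ∀ m k → + narayana (m + suc k) (suc k) ≡ sgn m ℤ.* sumTo m (signed-summand m k)
narayana-expansion zero          k = narayana-expansion-0 k
narayana-expansion (suc zero)    k = narayana-expansion-1 k
narayana-expansion (suc (suc m)) k =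
  transfer-expansion {suc m * suc (suc m)} {suc (suc (suc m)) * suc (suc m)} {suc k * suc (suc k)}
    {narayana (suc (suc m) + suc k) (suc k)} {narayana n (suc (suc k))} {sgn (suc m)}
    {sumTo (suc (suc m)) (signed-summand (suc (suc m)) k)} {sumTo (suc m) (signed-summand (suc m) (suc k))}
    column-ratio (narayana-expansion (suc m) (suc k)) (wz-sum (suc m) k)
  where
  n = suc m + suc (suc k)
  n∸k≡ : suc m + suc (suc k) ≡ k + suc (suc (suc m))
  n∸k≡ = solve (m ∷ k ∷ [])
  n∸1+k≡ : m + suc (suc k) ≡ k + suc (suc m)
  n∸1+k≡ = solve (m ∷ k ∷ [])
  column-ratio : suc (suc (suc m)) * suc (suc m) * narayana (suc (suc m) + suc k) (suc k)
                 ≡ suc k * suc (suc k) * narayana n (suc (suc k))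
  column-ratio = begin
    suc (suc (suc m)) * suc (suc m) * narayana (suc (suc m) + suc k) (suc k)
      ≡⟨ cong₂ (λ c t → c * narayana t (suc k))
               (sym (cong₂ _*_ (m≡n+o⇒m∸n≡o k (suc (suc (suc m))) n∸k≡)
                               (m≡n+o⇒m∸n≡o k (suc (suc m)) n∸1+k≡)))
               (sym (+-suc (suc m) (suc k))) ⟩
    (n ∸ k) * (n ∸ suc k) * narayana n (suc k)      ≡⟨ narayana-column-ratio n k ⟩
    suc k * suc (suc k) * narayana n (suc (suc k))  ∎

summand-agrees : ∀ m k j → j ≤ m →
  ((m + suc k + j ∸ 1) C (m + j)) * ((2 * (m + suc k) ∸ suc k) C (m ∸ j)) * narayana (m + j) j ≡ summand m k j
summand-agrees m k j j≤m = cong₂ (λ s t → (s C (m + j)) * t * narayana (m + j) j) upper mirrored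
  where
  top≡ : m + suc k + j ≡ 1 + (m + k + j)
  top≡ = solve (m ∷ k ∷ j ∷ [])
  upper : m + suc k + j ∸ 1 ≡ m + k + j
  upper = m≡n+o⇒m∸n≡o 1 (m + k + j) top≡
  width≡ : 2 * (m + suc k) ≡ suc k + (m + m + suc k)
  width≡ = solve (m ∷ k ∷ [])
  regroup : ∀ t m k j → t + (m + k + j) ≡ (t + j) + (m + k)
  regroup = solve-∀
  complement : m + m + suc k ≡ (m ∸ j) + (m + suc k + j)
  complement = sym (trans (regroup (m ∸ j) m (suc k) j)
                          (trans (cong (_+ (m + suc k)) (m∸n+n≡m j≤m)) (sym (+-assoc m m (suc k)))))
  m∸j≤width : m ∸ j ≤ m + m + suc k
  m∸j≤width = ≤-trans (m∸n≤m m j) (≤-trans (m≤m+n m m) (m≤m+n (m + m) (suc k)))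
  mirror-index : m + m + suc k ∸ (m ∸ j) ≡ m + suc k + j
  mirror-index = m≡n+o⇒m∸n≡o (m ∸ j) (m + suc k + j) complement
  mirrored : (2 * (m + suc k) ∸ suc k) C (m ∸ j) ≡ (m + m + suc k) C (m + suc k + j)
  mirrored = begin
    (2 * (m + suc k) ∸ suc k) C (m ∸ j)          ≡⟨ cong (_C (m ∸ j)) (m≡n+o⇒m∸n≡o (suc k) (m + m + suc k) width≡) ⟩
    (m + m + suc k) C (m ∸ j)                    ≡⟨ nCk≡nC[n∸k] m∸j≤width ⟩
    (m + m + suc k) C (m + m + suc k ∸ (m ∸ j))  ≡⟨ cong ((m + m + suc k) C_) mirror-index ⟩
    (m + m + suc k) C (m + suc k + j)            ∎

NarayanaIdentity : ℕ → ℕ → Set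
NarayanaIdentity n k =
  + narayana n k ≡
    sgn (n ∸ k) ℤ.* sumTo (n ∸ k) (λ j →
      sgn j ℤ.* + (((n + j ∸ 1) C (n ∸ k + j)) * ((2 * n ∸ k) C (n ∸ k ∸ j)) * narayana (n ∸ k + j) j))

narayana-identity-suc : ∀ m k → NarayanaIdentity (m + suc k) (suc k)
narayana-identity-suc m k rewrite m+n∸n≡m m (suc k) =
  trans (narayana-expansion m k)
        (cong (sgn m ℤ.*_) (sumTo-cong m (λ j j≤m → cong (λ t → sgn j ℤ.* + t) (sym (summand-agrees m k j j≤m)))))

-- For k = 0 and n ≥ 1 every summand contains the factor C(n + j − 1, n + j) = 0.
narayana-identity-zero : ∀ n → NarayanaIdentity (suc n) 0
narayana-identity-zero n =
  sym (trans (cong (sgn (suc n) ℤ.*_) (sumTo-vanishing (suc n) term-vanishes)) (ℤ.*-zeroʳ (sgn (suc n))))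
  where
  term-vanishes : ∀ j → sgn j ℤ.* + (((n + j) C suc (n + j)) * ((2 * suc n) C (suc n ∸ j)) * narayana (suc n + j) j)
                        ≡ + 0
  term-vanishes j =
    trans (cong (λ t → sgn j ℤ.* + (t * ((2 * suc n) C (suc n ∸ j)) * narayana (suc n + j) j))
                (k>n⇒nCk≡0 (n<1+n (n + j))))
          (ℤ.*-zeroʳ (sgn j))

corollary6p2 : ∀ (n k : ℕ) → k ≤ n →
    + narayana n k ≡
      sgn (n ∸ k) ℤ.* sumTo (n ∸ k) (λ j →
        sgn j ℤ.* + (((n + j ∸ 1) C (n ∸ k + j))
                     * ((2 * n ∸ k) C (n ∸ k ∸ j))
                     * narayana (n ∸ k + j) j))
corollary6p2 zero    zero    _   = refl
corollary6p2 (suc n) zero    _   = narayana-identity-zero n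
corollary6p2 n       (suc k) k≤n =
  subst (λ n → NarayanaIdentity n (suc k)) (m∸n+n≡m k≤n) (narayana-identity-suc (n ∸ suc k) k)
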